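{- If $G$ is a graph on $n$ vertices with vertex connectivity $\kappa$, then $\mathrm{th}_{\mathrm{H}}(G)\geq \lceil 2\sqrt{n-\kappa}+\kappa-1\rceil$.
   Context: All graphs are finite, simple and undirected; $N(v)$ is the open neighborhood of $v$. Vertices are colored blue or white. Under the hopping color change rule, a blue vertex $v$ may force a white vertex $w$ (not necessarily adjacent to $v$) to become blue provided $v$ has not previously performed a force and every vertex of $N(v)$ is blue. Starting from an initial blue set $B\subseteq V(G)$, a chronological list of forces is a sequence of valid forces performed one at a time until no further force is possible; its unordered set of forces is a set of forces of $B$. $B$ is a hopping forcing set if some chronological list turns every vertex blue. For a set of forces $\mathcal F$ of $B$, put $\mathcal F^{(0)}=B$ and, for $t>0$, let $\mathcal F^{(t)}$ be the set of vertices $w$ for which there is a force $v\to w$ in $\mathcal F$ with $v\in\bigcup_{i<t}\mathcal F^{(i)}$ that is a valid hopping force when exactly the vertices of $\bigcup_{i<t}\mathcal F^{(i)}$ are blue. $\mathrm{pt}_{\mathrm{H}}(G;\mathcal F)$ is the least $t$ with $\bigcup_{i\le t}\mathcal F^{(i)}=V(G)$, and $\mathrm{pt}_{\mathrm{H}}(G;B)$ is the minimum of $\mathrm{pt}_{\mathrm{H}}(G;\mathcal F)$ over sets of forces $\mathcal F$ of $B$ ($\infty$ if $B$ is not a hopping forcing set). The hopping throttling number is $\mathrm{th}_{\mathrm{H}}(G)=\min_{B\subseteq V(G)}\big(|B|+\mathrm{pt}_{\mathrm{H}}(G;B)\big)$. -}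

module Defs where

open import Data.Nat using (ℕ; zero; suc; _+_; _*_; _∸_; _≤_)
open import Data.Fin using (Fin)
open import Data.Fin.Subset using (Subset; _∈_; _∉_; _∪_; ⁅_⁆; ∣_∣; ⊥)
open import Data.Bool using (Bool; true; false)
open import Data.List using (List; []; _∷_)
open import Data.List.Membership.Propositional using () renaming (_∈_ to _∈ₗ_)
open import Data.Product using (Σ; ∃; ∃-syntax; _×_; _,_)
open import Data.Sum using (_⊎_)
open import Relation.Binary.PropositionalEquality using (_≡_)
open import Relation.Nullary using (¬_)

record Graph (n : ℕ) : Set where
  field
    adj    : Fin n → Fin n → Bool
    sym    : ∀ u v → adj u v ≡ adj v u
    irrefl : ∀ v → adj v v ≡ false
open Graph public

_∈N[_]_ : ∀ {n} → Fin n → Graph n → Fin n → Set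
u ∈N[ G ] v = adj G v u ≡ true

data Reachable {n} (G : Graph n) (S : Subset n) : Fin n → Fin n → Set where
  here : ∀ {u} → u ∉ S → Reachable G S u u
  step : ∀ {u v w} → Reachable G S u v → w ∈N[ G ] v → w ∉ S →
         Reachable G S u w

Separating : ∀ {n} → Graph n → Subset n → Set
Separating G S =
  (∃[ u ] ∃[ v ] (u ∉ S × v ∉ S × ¬ Reachable G S u v))
  ⊎ (∀ u v → u ∉ S → v ∉ S → u ≡ v)

-- κ is the vertex connectivity of G: the minimum size of a set S such
-- that G − S is disconnected or trivial (so κ(K_n) = n − 1)
IsVertexConnectivity : ∀ {n} → Graph n → ℕ → Set
IsVertexConnectivity G κ =
  (∃[ S ] (∣ S ∣ ≡ κ × Separating G S))
  × (∀ S → Separating G S → κ ≤ ∣ S ∣)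

-- With blue set S and set U of vertices that have already forced,
-- v → w is a valid hopping force.
ValidHop : ∀ {n} → Graph n → Subset n → Subset n → Fin n → Fin n → Set
ValidHop G S U v w =
  v ∈ S × v ∉ U × w ∉ S × (∀ u → u ∈N[ G ] v → u ∈ S)

data Chrono {n} (G : Graph n) : Subset n → Subset n →
            List (Fin n × Fin n) → Set where
  done : ∀ {S U} → (¬ (∃[ v ] ∃[ w ] ValidHop G S U v w)) → Chrono G S U []
  step : ∀ {S U v w L} → ValidHop G S U v w →
         Chrono G (S ∪ ⁅ w ⁆) (U ∪ ⁅ v ⁆) L →
         Chrono G S U ((v , w) ∷ L)

-- L is a chronological list of hopping forces of B (its set of forces is
-- the set of its entries).
IsChronList : ∀ {n} → Graph n → Subset n → List (Fin n × Fin n) → Set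
IsChronList G B L = Chrono G B ⊥ L

-- BlueBy G B F t x : x ∈ F^(0) ∪ … ∪ F^(t)  for the set of forces F
-- (membership in the list F).
BlueBy : ∀ {n} → Graph n → Subset n → List (Fin n × Fin n) → ℕ → Fin n → Set
BlueBy G B F zero    x = x ∈ B
BlueBy G B F (suc t) x =
  BlueBy G B F t x
  ⊎ (∃[ v ] ((v , x) ∈ₗ F × BlueBy G B F t v × ¬ BlueBy G B F t x
             × (∀ u → u ∈N[ G ] v → BlueBy G B F t u)))

AllBlueBy : ∀ {n} → Graph n → Subset n → List (Fin n × Fin n) → ℕ → Set
AllBlueBy G B F t = ∀ x → BlueBy G B F t x

IsHoppingThrottlingNumber : ∀ {n} → Graph n → ℕ → Set
IsHoppingThrottlingNumber G th =
  (∃[ B ] ∃[ F ] ∃[ t ] (IsChronList G B F × AllBlueBy G B F t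
                          × ∣ B ∣ + t ≡ th))
  × (∀ B F t → IsChronList G B F → AllBlueBy G B F t → th ≤ ∣ B ∣ + t)

-- CeilBound m κ th  :⇔  ⌈ 2√m + κ − 1 ⌉ ≤ th   (for naturals m, κ, th).
-- Since th is an integer this is  2√m ≤ th + 1 − κ, i.e.
-- κ ≤ th + 1 and 4m ≤ (th + 1 − κ)².
CeilBound : ℕ → ℕ → ℕ → Set
CeilBound m κ th = κ ≤ suc th × 4 * m ≤ (suc th ∸ κ) * (suc th ∸ κ)

{-# OPTIONS --safe #-}
-- Let Bₜ be the set of vertices that are blue after t rounds of a set of
-- forces F of B. A vertex forcing in round t + 1 is blue with all its
-- neighbours blue, so it lies outside the set ∂ₜ of blue vertices with a
-- white neighbour; as every vertex forces at most once,
-- |Bₜ₊₁| ≤ |B| + #forcers ≤ |B| + |Bₜ| − |∂ₜ|. If round t + 1 turns some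
-- vertex blue, ∂ₜ separates it from its forcer, so |∂ₜ| ≥ κ. Hence every
-- round adds at most |B| − κ vertices and n ≤ |B| + t(|B| − κ), i.e.
-- n − κ ≤ (|B| − κ)(t + 1), and AM–GM turns this into
-- 4(n − κ) ≤ (|B| + t + 1 − κ)².
module Submission where

open import Defs hiding (sym)
open import Data.Nat using (ℕ; zero; suc; _+_; _*_; _∸_; _≤_; z≤n)
open import Data.Nat.Properties
open import Data.Nat.Solver using (module +-*-Solver)
open import Algebra.Properties.CommutativeMonoid.Sum +-0-commutativeMonoid
  using (sum; ∑-distrib-+; ∑-comm)
open import Data.Bool using (true; if_then_else_) renaming (_≟_ to _≟ᵇ_)
open import Data.Fin using (Fin; zero; suc) renaming (_≟_ to _≟ᶠ_)
import Data.Fin.Properties as Finₚ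
open Finₚ using (any?; all?)
open import Data.Fin.Subset using (Subset; _∈_; _∉_; ∣_∣; ⊤; inside; outside)
open import Data.Fin.Subset.Properties using (_∈?_; ∈⊤; ∣⊤∣≡n; x∈⁅x⁆; x∈p∪q⁺)
open import Data.Vec using ([]; _∷_; tabulate)
open import Data.Vec.Properties using (lookup∘tabulate; []=⇒lookup; lookup⇒[]=)
open import Data.List using (List)
open import Data.List.Relation.Unary.Any using (here; there)
open import Data.List.Membership.Propositional using () renaming (_∈_ to _∈ₗ_)
import Data.List.Membership.DecPropositional as DecMembership
open import Data.Product using (∃-syntax; _×_; _,_; proj₁; proj₂)
open import Data.Product.Properties using (≡-dec)
open import Data.Sum using (_⊎_; inj₁; inj₂; [_,_]′)
open import Function using (_∘_)
open import Level using (Level; 0ℓ)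
open import Relation.Nullary using (¬_; Dec; yes; no; does; contradiction)
open import Relation.Nullary.Decidable using (_×-dec_; _⊎-dec_; _→-dec_; ¬?; dec-true; decidable-stable)
open import Relation.Unary using (Pred; Decidable)
open import Relation.Binary.PropositionalEquality

private
  variable
    a b c ℓ ℓ′ : Level
    A : Set a
    B : Set b
    C : Set c
    n : ℕ

∑-mono-≤ : {f g : Fin n → ℕ} → (∀ i → f i ≤ g i) → sum f ≤ sum g
∑-mono-≤ {zero}  f≤g = z≤n
∑-mono-≤ {suc n} f≤g = +-mono-≤ (f≤g zero) (∑-mono-≤ (λ i → f≤g (suc i)))

𝟙 : Dec A → ℕ
𝟙 a? = if does a? then 1 else 0

1≤𝟙 : (a? : Dec A) → A → 1 ≤ 𝟙 a?
1≤𝟙 (yes _) _ = ≤-refl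
1≤𝟙 (no ¬a) a = contradiction a ¬a

𝟙≤ : ∀ {m} (a? : Dec A) → (A → 1 ≤ m) → 𝟙 a? ≤ m
𝟙≤ (yes a) 1≤m = 1≤m a
𝟙≤ (no _)  _   = z≤n

𝟙-mono : (A → B) → (a? : Dec A) (b? : Dec B) → 𝟙 a? ≤ 𝟙 b?
𝟙-mono f a? b? = 𝟙≤ a? (λ a → 1≤𝟙 b? (f a))

𝟙-disjoint : (A → C) → (B → C) → (A → ¬ B) →
             (a? : Dec A) (b? : Dec B) (c? : Dec C) → 𝟙 a? + 𝟙 b? ≤ 𝟙 c?
𝟙-disjoint f g a⇒¬b (yes a) (yes b) _  = contradiction b (a⇒¬b a)
𝟙-disjoint f g a⇒¬b (yes a) (no _)  c? = 𝟙-mono f (yes a) c?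
𝟙-disjoint f g a⇒¬b (no _)  b?      c? = 𝟙-mono g b? c?

count : {P : Pred (Fin n) ℓ} → Decidable P → ℕ
count P? = sum (λ i → 𝟙 (P? i))

count-mono : {P : Pred (Fin n) ℓ} {Q : Pred (Fin n) ℓ′} (P? : Decidable P) (Q? : Decidable Q) →
             (∀ {i} → P i → Q i) → count P? ≤ count Q?
count-mono P? Q? P⇒Q = ∑-mono-≤ (λ i → 𝟙-mono P⇒Q (P? i) (Q? i))

count-cong : {P : Pred (Fin n) ℓ} {Q : Pred (Fin n) ℓ′} (P? : Decidable P) (Q? : Decidable Q) →
             (∀ {i} → P i → Q i) → (∀ {i} → Q i → P i) → count P? ≡ count Q?
count-cong P? Q? P⇒Q Q⇒P = ≤-antisym (count-mono P? Q? P⇒Q) (count-mono Q? P? Q⇒P)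

1≤count : {P : Pred (Fin n) ℓ} (P? : Decidable P) {i : Fin n} → P i → 1 ≤ count P?
1≤count P? {zero}  p = ≤-trans (1≤𝟙 (P? zero) p) (m≤m+n _ _)
1≤count P? {suc i} p = ≤-trans (1≤count (λ j → P? (suc j)) p) (m≤n+m _ _)

count-all : {P : Pred (Fin n) ℓ} (P? : Decidable P) → (∀ i → P i) → count P? ≡ n
count-all {zero}  P? all = refl
count-all {suc n} P? all with P? zero
... | yes _  = cong suc (count-all (λ i → P? (suc i)) (λ i → all (suc i)))
... | no ¬p0 = contradiction (all zero) ¬p0

count-none : {P : Pred (Fin n) ℓ} (P? : Decidable P) → (∀ i → ¬ P i) → count P? ≡ 0
count-none {zero}  P? none = refl
count-none {suc n} P? none with P? zero
... | yes p0 = contradiction p0 (none zero)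
... | no _   = count-none (λ i → P? (suc i)) (λ i → none (suc i))

AtMostOne : Pred (Fin n) ℓ → Set ℓ
AtMostOne P = ∀ {i j} → P i → P j → i ≡ j

count-atMostOne : {P : Pred (Fin n) ℓ} (P? : Decidable P) → AtMostOne P →
                  (a? : Dec A) → (∀ {i} → P i → A) → count P? ≤ 𝟙 a?
count-atMostOne {zero}  P? unique a? P⇒A = z≤n
count-atMostOne {suc n} P? unique a? P⇒A with P? zero
... | yes p0 = ≤-trans (≤-reflexive (cong suc rest-empty)) (1≤𝟙 a? (P⇒A p0))
  where
  rest-empty : count (λ i → P? (suc i)) ≡ 0
  rest-empty = count-none (λ i → P? (suc i)) (λ i p → Finₚ.0≢1+n (unique p0 p))
... | no _   = count-atMostOne (λ i → P? (suc i)) (λ p q → Finₚ.suc-injective (unique p q)) a? P⇒A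

∣p∣≡count∈ : (p : Subset n) → ∣ p ∣ ≡ count (_∈? p)
∣p∣≡count∈ []            = refl
∣p∣≡count∈ (inside  ∷ p) = cong suc (∣p∣≡count∈ p)
∣p∣≡count∈ (outside ∷ p) = ∣p∣≡count∈ p

⟦_⟧ : {P : Pred (Fin n) ℓ} → Decidable P → Subset n
⟦ P? ⟧ = tabulate (λ i → does (P? i))

module _ {P : Pred (Fin n) ℓ} (P? : Decidable P) where

  ∈⟦⟧⁺ : ∀ {i} → P i → i ∈ ⟦ P? ⟧
  ∈⟦⟧⁺ {i} p = lookup⇒[]= i ⟦ P? ⟧ (trans (lookup∘tabulate _ i) (dec-true (P? i) p))

  ∈⟦⟧⁻ : ∀ {i} → i ∈ ⟦ P? ⟧ → P i
  ∈⟦⟧⁻ {i} i∈ with P? i | trans (sym (lookup∘tabulate (λ j → does (P? j)) i)) ([]=⇒lookup i∈)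
  ... | yes p | _  = p
  ... | no _  | ()

  ∣⟦⟧∣≡count : ∣ ⟦ P? ⟧ ∣ ≡ count P?
  ∣⟦⟧∣≡count = trans (∣p∣≡count∈ ⟦ P? ⟧) (count-cong (_∈? ⟦ P? ⟧) P? ∈⟦⟧⁻ ∈⟦⟧⁺)

am-gm-≤ : ∀ {m n} → m ≤ n → 4 * (m * n) ≤ (m + n) * (m + n)
am-gm-≤ {m} {n} m≤n = subst (λ k → 4 * (m * k) ≤ (m + k) * (m + k)) (m+[n∸m]≡n m≤n) (am-gm-+ m (n ∸ m))
  where
  open +-*-Solver
  am-gm-+ : ∀ m d → 4 * (m * (m + d)) ≤ (m + (m + d)) * (m + (m + d))
  am-gm-+ m d = ≤-trans (m≤m+n _ (d * d)) (≤-reflexive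
    (solve 2 (λ m d → con 4 :* (m :* (m :+ d)) :+ d :* d := (m :+ (m :+ d)) :* (m :+ (m :+ d))) refl m d))

am-gm : ∀ m n → 4 * (m * n) ≤ (m + n) * (m + n)
am-gm m n with ≤-total m n
... | inj₁ m≤n = am-gm-≤ m≤n
... | inj₂ n≤m = subst₂ _≤_ (cong (4 *_) (*-comm n m)) (cong₂ _*_ (+-comm n m) (+-comm n m)) (am-gm-≤ n≤m)

m+k≤b+c⇒m≤c+[b∸k] : ∀ {m k b c} → m + k ≤ b + c → m ≤ c + (b ∸ k)
m+k≤b+c⇒m≤c+[b∸k] {m} {k} {b} {c} le = +-cancelˡ-≤ k m _ (begin
  k + m             ≡⟨ +-comm k m ⟩
  m + k             ≤⟨ le ⟩
  b + c             ≤⟨ +-monoˡ-≤ c (m≤n+m∸n b k) ⟩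
  k + (b ∸ k) + c   ≡⟨ +-assoc k _ c ⟩
  k + (b ∸ k + c)   ≡⟨ cong (k +_) (+-comm (b ∸ k) c) ⟩
  k + (c + (b ∸ k)) ∎)
  where open ≤-Reasoning

ceilBound-+ : ∀ {n κ d t} → n ≤ (κ + d) + t * d → CeilBound (n ∸ κ) κ ((κ + d) + t)
ceilBound-+ {n} {κ} {d} {t} n≤ = m≤n⇒m≤1+n (≤-trans (m≤m+n κ d) (m≤m+n (κ + d) t)) , bound
  where
  open +-*-Solver
  budget : suc ((κ + d) + t) ∸ κ ≡ d + suc t
  budget = trans (cong (_∸ κ) (solve 3 (λ κ d t → con 1 :+ ((κ :+ d) :+ t) := κ :+ (d :+ (con 1 :+ t))) refl κ d t))
                 (m+n∸m≡n κ (d + suc t))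
  n∸κ≤ : n ∸ κ ≤ d * suc t
  n∸κ≤ = m≤n+o⇒m∸n≤o n κ (≤-trans n≤ (≤-reflexive
           (solve 3 (λ κ d t → (κ :+ d) :+ t :* d := κ :+ d :* (con 1 :+ t)) refl κ d t)))
  bound : 4 * (n ∸ κ) ≤ (suc ((κ + d) + t) ∸ κ) * (suc ((κ + d) + t) ∸ κ)
  bound rewrite budget = ≤-trans (*-monoʳ-≤ 4 n∸κ≤) (am-gm d (suc t))

m≤n≤b+t*[b∸m]⇒m≤b : ∀ {m n b} t → m ≤ n → n ≤ b + t * (b ∸ m) → m ≤ b
m≤n≤b+t*[b∸m]⇒m≤b {m} {n} {b} t m≤n n≤ = ≮⇒≥ λ b<m → <⇒≱ b<m (≤-trans m≤n (≤-trans n≤ (≤-reflexive (begin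
  b + t * (b ∸ m) ≡⟨ cong (λ k → b + t * k) (m≤n⇒m∸n≡0 (<⇒≤ b<m)) ⟩
  b + t * 0       ≡⟨ cong (b +_) (*-zeroʳ t) ⟩
  b + 0           ≡⟨ +-identityʳ b ⟩
  b               ∎))))
  where open ≡-Reasoning

ceilBound : ∀ {n κ} b t → κ ≤ n → n ≤ b + t * (b ∸ κ) → CeilBound (n ∸ κ) κ (b + t)
ceilBound {n} {κ} b t κ≤n n≤ with m≤n⇒∃[o]m+o≡n (m≤n≤b+t*[b∸m]⇒m≤b t κ≤n n≤)
... | d , refl = ceilBound-+ (subst (λ e → n ≤ (κ + d) + t * e) (m+n∸m≡n κ d) n≤)

adjacent? : (G : Graph n) (v u : Fin n) → Dec (u ∈N[ G ] v)
adjacent? G v u = adj G v u ≟ᵇ true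

reachable-end-∉ : ∀ {G : Graph n} {S u y} → Reachable G S u y → y ∉ S
reachable-end-∉ (here u∉S)     = u∉S
reachable-end-∉ (step _ _ w∉S) = w∉S

connectivity≤order : (G : Graph n) {κ : ℕ} → (∀ S → Separating G S → κ ≤ ∣ S ∣) → κ ≤ n
connectivity≤order {n} G κ-min =
  subst (_ ≤_) (∣⊤∣≡n n) (κ-min ⊤ (inj₂ (λ u v u∉⊤ _ → contradiction ∈⊤ u∉⊤)))

module Boundary (G : Graph n) {X : Pred (Fin n) ℓ} (X? : Decidable X) where

  OnBoundary : Pred (Fin n) ℓ
  OnBoundary y = X y × ∃[ w ] (w ∈N[ G ] y × ¬ X w)

  boundary? : Decidable OnBoundary
  boundary? y = X? y ×-dec any? (λ w → adjacent? G y w ×-dec ¬? (X? w))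

  ∂ : Subset n
  ∂ = ⟦ boundary? ⟧

  reachable-stays : ∀ {u y} → X u → Reachable G ∂ u y → X y
  reachable-stays xu (here _) = xu
  reachable-stays xu (step {v = y} {w = w} u⇝y w~y _) with X? w
  ... | yes xw = xw
  ... | no ¬xw = contradiction (∈⟦⟧⁺ boundary? (reachable-stays xu u⇝y , w , w~y , ¬xw))
                               (reachable-end-∉ u⇝y)

  ∂-separates : ∀ {v w} → X v → (∀ u → u ∈N[ G ] v → X u) → ¬ X w → Separating G ∂
  ∂-separates {v} {w} xv N[v]⊆X ¬xw = inj₁ (v , w , v∉∂ , w∉∂ , λ v⇝w → ¬xw (reachable-stays xv v⇝w))
    where
    v∉∂ : v ∉ ∂
    v∉∂ v∈∂ = let (_ , u , u~v , ¬xu) = ∈⟦⟧⁻ boundary? v∈∂ in ¬xu (N[v]⊆X u u~v)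
    w∉∂ : w ∉ ∂
    w∉∂ w∈∂ = ¬xw (proj₁ (∈⟦⟧⁻ boundary? w∈∂))

module _ {G : Graph n} where

  chrono-forcer-unused : ∀ {S U L v w} → Chrono G S U L → (v , w) ∈ₗ L → v ∉ U
  chrono-forcer-unused (step (_ , v∉U , _) _) (here refl) = v∉U
  chrono-forcer-unused (step _ rest)          (there vw∈L) v∈U =
    chrono-forcer-unused rest vw∈L (x∈p∪q⁺ (inj₁ v∈U))

  chrono-forces-once : ∀ {S U L v w w′} → Chrono G S U L →
                       (v , w) ∈ₗ L → (v , w′) ∈ₗ L → w ≡ w′
  chrono-forces-once (step _ _)    (here refl)   (here refl)    = refl
  chrono-forces-once (step _ rest) (here refl)   (there vw′∈L)  =
    contradiction (x∈p∪q⁺ (inj₂ (x∈⁅x⁆ _))) (chrono-forcer-unused rest vw′∈L)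
  chrono-forces-once (step _ rest) (there vw∈L)  (here refl)    =
    contradiction (x∈p∪q⁺ (inj₂ (x∈⁅x⁆ _))) (chrono-forcer-unused rest vw∈L)
  chrono-forces-once (step _ rest) (there vw∈L)  (there vw′∈L)  = chrono-forces-once rest vw∈L vw′∈L

module Propagation (G : Graph n) (B : Subset n) (F : List (Fin n × Fin n)) where

  open DecMembership (≡-dec (_≟ᶠ_ {n}) (_≟ᶠ_ {n})) using () renaming (_∈?_ to _∈ₗ?_)

  Blue : ℕ → Pred (Fin n) 0ℓ
  Blue = BlueBy G B F

  Ready : ℕ → Pred (Fin n) 0ℓ
  Ready t v = ∀ u → u ∈N[ G ] v → Blue t u

  Active : ℕ → Pred (Fin n) 0ℓ
  Active t v = Blue t v × Ready t v

  Forces : ℕ → Fin n → Fin n → Set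
  Forces t v w = (v , w) ∈ₗ F × Active t v

  blue?  : ∀ t → Decidable (Blue t)
  ready? : ∀ t → Decidable (Ready t)

  blue? zero    x = x ∈? B
  blue? (suc t) x = blue? t x ⊎-dec
    any? (λ v → (v , x) ∈ₗ? F ×-dec blue? t v ×-dec ¬? (blue? t x) ×-dec ready? t v)

  ready? t v = all? (λ u → adjacent? G v u →-dec blue? t u)

  active? : ∀ t → Decidable (Active t)
  active? t v = blue? t v ×-dec ready? t v

  forces? : ∀ t v → Decidable (Forces t v)
  forces? t v w = (v , w) ∈ₗ? F ×-dec active? t v

  module BoundaryAt (t : ℕ) = Boundary G (blue? t)

  active-suc : ∀ {t v} → Active t v → Active (suc t) v
  active-suc (bv , rv) = inj₁ bv , λ u u~v → inj₁ (rv u u~v)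

  blue-suc-origin : ∀ t {w} → Blue (suc t) w → w ∈ B ⊎ ∃[ v ] Forces t v w
  blue-suc-origin t       (inj₂ (v , vw∈F , bv , _ , rv)) = inj₂ (v , vw∈F , bv , rv)
  blue-suc-origin zero    (inj₁ w∈B) = inj₁ w∈B
  blue-suc-origin (suc t) (inj₁ bw)  with blue-suc-origin t bw
  ... | inj₁ w∈B            = inj₁ w∈B
  ... | inj₂ (v , vw∈F , a) = inj₂ (v , vw∈F , active-suc a)

  newly-blue-active : ∀ {t w} → Blue (suc t) w → ¬ Blue t w → ∃[ v ] Active t v
  newly-blue-active (inj₁ bw)                  ¬bw = contradiction bw ¬bw
  newly-blue-active (inj₂ (v , _ , bv , _ , rv)) _ = v , bv , rv

  count-active+∂≤count-blue : ∀ t → count (active? t) + ∣ BoundaryAt.∂ t ∣ ≤ count (blue? t)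
  count-active+∂≤count-blue t = begin
    count (active? t) + ∣ BoundaryAt.∂ t ∣
      ≡⟨ cong (count (active? t) +_) (∣⟦⟧∣≡count (BoundaryAt.boundary? t)) ⟩
    count (active? t) + count (BoundaryAt.boundary? t)
      ≡⟨ sym (∑-distrib-+ (λ v → 𝟙 (active? t v)) (λ v → 𝟙 (BoundaryAt.boundary? t v))) ⟩
    sum (λ v → 𝟙 (active? t v) + 𝟙 (BoundaryAt.boundary? t v))
      ≤⟨ ∑-mono-≤ (λ v → 𝟙-disjoint proj₁ proj₁ ready⇒¬boundary
                                     (active? t v) (BoundaryAt.boundary? t v) (blue? t v)) ⟩
    count (blue? t) ∎
    where
    open ≤-Reasoning
    ready⇒¬boundary : ∀ {v} → Active t v → ¬ BoundaryAt.OnBoundary t v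
    ready⇒¬boundary (_ , rv) (_ , w , w~v , ¬bw) = ¬bw (rv w w~v)

  module _ (forces-once : ∀ {v w w′} → (v , w) ∈ₗ F → (v , w′) ∈ₗ F → w ≡ w′) where

    count-blue-suc : ∀ t → count (blue? (suc t)) ≤ ∣ B ∣ + count (active? t)
    count-blue-suc t = begin
      count (blue? (suc t))
        ≤⟨ ∑-mono-≤ (λ w → 𝟙≤ (blue? (suc t) w) ([ in-B w , forced w ]′ ∘ blue-suc-origin t)) ⟩
      sum (λ w → 𝟙 (w ∈? B) + count (λ v → forces? t v w))
        ≡⟨ ∑-distrib-+ (λ w → 𝟙 (w ∈? B)) (λ w → count (λ v → forces? t v w)) ⟩
      count (_∈? B) + sum (λ w → count (λ v → forces? t v w))
        ≡⟨ cong₂ _+_ (sym (∣p∣≡count∈ B)) (∑-comm (λ w v → 𝟙 (forces? t v w))) ⟩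
      ∣ B ∣ + sum (λ v → count (forces? t v))
        ≤⟨ +-monoʳ-≤ ∣ B ∣ (∑-mono-≤ forcer-count) ⟩
      ∣ B ∣ + count (active? t) ∎
      where
      open ≤-Reasoning
      in-B : ∀ w → w ∈ B → 1 ≤ 𝟙 (w ∈? B) + count (λ v → forces? t v w)
      in-B w w∈B = ≤-trans (1≤𝟙 (w ∈? B) w∈B) (m≤m+n _ _)
      forced : ∀ w → ∃[ v ] Forces t v w → 1 ≤ 𝟙 (w ∈? B) + count (λ v → forces? t v w)
      forced w (v , f) = ≤-trans (1≤count (λ v → forces? t v w) f) (m≤n+m _ _)
      forcer-count : ∀ v → count (forces? t v) ≤ 𝟙 (active? t v)
      forcer-count v = count-atMostOne (forces? t v) (λ (f , _) (f′ , _) → forces-once f f′)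
                                       (active? t v) proj₂

    module _ {κ} (κ-min : ∀ S → Separating G S → κ ≤ ∣ S ∣) where

      blue-growth : ∀ t → count (blue? (suc t)) ≤ count (blue? t) + (∣ B ∣ ∸ κ)
      blue-growth t with any? (λ w → blue? (suc t) w ×-dec ¬? (blue? t w))
      ... | no no-new = ≤-trans (count-mono (blue? (suc t)) (blue? t) stays) (m≤m+n _ _)
        where
        stays : ∀ {w} → Blue (suc t) w → Blue t w
        stays {w} bw′ = decidable-stable (blue? t w) (λ ¬bw → no-new (w , bw′ , ¬bw))
      ... | yes (w , bw′ , ¬bw) with newly-blue-active bw′ ¬bw
      ...   | _ , bv , rv = m+k≤b+c⇒m≤c+[b∸k] (begin
        count (blue? (suc t)) + κ
          ≤⟨ +-monoʳ-≤ _ (κ-min (BoundaryAt.∂ t) (BoundaryAt.∂-separates t bv rv ¬bw)) ⟩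
        count (blue? (suc t)) + ∣ BoundaryAt.∂ t ∣
          ≤⟨ +-monoˡ-≤ _ (count-blue-suc t) ⟩
        ∣ B ∣ + count (active? t) + ∣ BoundaryAt.∂ t ∣
          ≡⟨ +-assoc ∣ B ∣ _ _ ⟩
        ∣ B ∣ + (count (active? t) + ∣ BoundaryAt.∂ t ∣)
          ≤⟨ +-monoʳ-≤ ∣ B ∣ (count-active+∂≤count-blue t) ⟩
        ∣ B ∣ + count (blue? t) ∎)
        where open ≤-Reasoning

      blue-count-bound : ∀ t → count (blue? t) ≤ ∣ B ∣ + t * (∣ B ∣ ∸ κ)
      blue-count-bound zero    = ≤-reflexive (trans (sym (∣p∣≡count∈ B)) (sym (+-identityʳ ∣ B ∣)))
      blue-count-bound (suc t) = begin
        count (blue? (suc t))                 ≤⟨ blue-growth t ⟩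
        count (blue? t) + d                   ≤⟨ +-monoˡ-≤ d (blue-count-bound t) ⟩
        ∣ B ∣ + t * d + d                     ≡⟨ +-assoc ∣ B ∣ (t * d) d ⟩
        ∣ B ∣ + (t * d + d)                   ≡⟨ cong (∣ B ∣ +_) (+-comm (t * d) d) ⟩
        ∣ B ∣ + suc t * d                     ∎
        where
        open ≤-Reasoning
        d = ∣ B ∣ ∸ κ

theorem3p1 : (n : ℕ) (G : Graph n) (κ th : ℕ) →
    IsVertexConnectivity G κ → IsHoppingThrottlingNumber G th →
    CeilBound (n ∸ κ) κ th
theorem3p1 n G κ th (_ , κ-min) ((B , F , t , chrono , all-blue , refl) , _) =
  ceilBound ∣ B ∣ t (connectivity≤order G κ-min) (begin
    n                        ≡⟨ sym (count-all (blue? t) all-blue) ⟩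
    count (blue? t)          ≤⟨ blue-count-bound (chrono-forces-once chrono) κ-min t ⟩
    ∣ B ∣ + t * (∣ B ∣ ∸ κ)  ∎)
  where
  open Propagation G B F
  open ≤-Reasoning
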